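{- Let $k$ be a positive integer. For each positive integer $n$, let $x_n = 0.(kn)(k(n+1))(k(n+2))(k(n+3))\dots$ be the real number whose decimal expansion after the decimal point is obtained by concatenating the decimal representations of the integers $kn, k(n+1), k(n+2), \dots$ in this order. Then the sequence $(x_n)_{n\ge1}$ is not uniformly distributed modulo $1$ over $[0.1,1)$.
   Context: For a real number $x$, $\{x\}$ denotes its fractional part. For a sequence of real numbers $(x_n)_n$, a set $E\subseteq[0,1]$ and $N\ge 1$, $A(E;N;(x_n)_n)$ denotes the number of indices $n$ with $1\le n\le N$ and $\{x_n\}\in E$. A sequence $(x_n)_n$ is called uniformly distributed modulo $1$ over $[\alpha,\beta)\subseteq[0,1)$ if for every pair of reals $\alpha\le a<b\le\beta$, $$\lim_{N\to\infty}\frac{A([a,b);N;(x_n)_n)}{N}=\frac{b-a}{\beta-\alpha}.$$ -}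

module Defs where

open import Data.Nat as ℕ using (ℕ; zero; suc; _+_; _*_; _^_)
open import Data.List using (List; []; _∷_; _++_; take; foldl; concatMap; upTo; map)
open import Data.Nat.Properties using (m^n≢0)
open import Data.Digit using (toNatDigits)
open import Data.Integer using (+_)
open import Data.Rational as ℚ using (ℚ; _/_; _≤_; _<_; ∣_∣; _-_)
open import Data.Product using (Σ; _×_; ∃)
open import Relation.Nullary using (¬_)

decDigits : ℕ → List ℕ
decDigits m = toNatDigits 10 m

-- The first `len` decimal digits (after the decimal point) of
-- x_n = 0.(kn)(k(n+1))(k(n+2))...  Each block contributes at least one
-- digit, so the first `len` blocks suffice.
prefixDigits : (k n len : ℕ) → List ℕ
prefixDigits k n len = take len (concatMap (λ j → decDigits (k * (n + j))) (upTo len))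

digitsValue : List ℕ → ℕ
digitsValue = foldl (λ acc d → 10 * acc + d) 0

trunc : (k n m : ℕ) → ℚ
trunc k n m = (+ digitsValue (prefixDigits k n m)) / (10 ^ m)
  where instance _ = m^n≢0 10 m

tenPowNeg : ℕ → ℚ
tenPowNeg m = (+ 1) / (10 ^ m)
  where instance _ = m^n≢0 10 m

-- The real number x_n (a stream of decimal digits) compared with rationals:
-- a ≤ x_n  iff  every truncation satisfies a ≤ trunc_m + 10^{-m};
-- x_n < b  iff  some truncation satisfies trunc_m + 10^{-m} < b.
LeX : (k n : ℕ) → ℚ → Set
LeX k n a = ∀ m → a ≤ trunc k n m ℚ.+ tenPowNeg m

XLt : (k n : ℕ) → ℚ → Set
XLt k n b = ∃ λ m → trunc k n m ℚ.+ tenPowNeg m < b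

-- Since 0.1 ≤ x_n < 1, the fractional part {x_n} is x_n itself.
-- {x_n} ∈ [a , b)
InInterval : (k n : ℕ) → ℚ → ℚ → Set
InInterval k n a b = LeX k n a × XLt k n b

-- CountIs P N c : c is the number of indices 1 ≤ n ≤ N with P n.
-- (Relational, since membership need not be decidable.)
data CountIs (P : ℕ → Set) : ℕ → ℕ → Set where
  cnt-zero : CountIs P 0 0
  cnt-yes  : ∀ {N c} → P (suc N) → CountIs P N c → CountIs P (suc N) (suc c)
  cnt-no   : ∀ {N c} → ¬ P (suc N) → CountIs P N c → CountIs P (suc N) c

RatioTendsTo : (P : ℕ → Set) → ℚ → Set
RatioTendsTo P L =
  ∀ (ε : ℚ) → ℚ.0ℚ < ε → ∃ λ N₀ → ∀ N → N₀ ℕ.≤ N → ∀ c → CountIs P (suc N) c →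
    ∣ ((+ c) / suc N) - L ∣ < ε

-- Uniform distribution modulo 1 of (x_n) over [0.1 , 1) (endpoints a, b
-- rational): for 1/10 ≤ a < b ≤ 1, A([a,b);N)/N → (b − a)/(1 − 1/10) = (b − a)·10/9.
UniformlyDistributedOverTenthToOne : (k : ℕ) → Set
UniformlyDistributedOverTenthToOne k =
  ∀ (a b : ℚ) → (+ 1) / 10 ≤ a → a < b → b ≤ ℚ.1ℚ →
    RatioTendsTo (λ n → InInterval k n a b) ((b - a) ℚ.* ((+ 10) / 9))

-- If x_n were uniformly distributed over [1/10, 1), the proportion of
-- x_1, …, x_N lying in [1/5, 1) would tend to (1 - 1/5)/(1 - 1/10) = 8/9.
-- Now take M = 10^T with T large and L = ⌊(M - 1)/k⌋.  For L < n ≤ 2L the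
-- multiple kn lies in [M, 2M - 2], so its decimal expansion, which is the
-- first block of digits of x_n, is 1 followed by T digits and not all nines;
-- hence x_n < 0.2.  So at most L of x_1, …, x_{2L} lie in [1/5, 1), a
-- proportion of at most 1/2, while N = 2L can be made as large as we like.
module Submission where

open import Defs
open import Data.Nat using (ℕ; NonZero)
open import Relation.Nullary using (¬_)

open import Data.Bool using (true; false)
open import Data.Digit using (toNatDigits)
open import Data.Integer as ℤ using (+_)
import Data.Integer.Properties as ℤ
open import Data.List using (List; []; _∷_; _++_; foldl; length; take)
open import Data.Nat using (zero; suc; pred; _+_; _*_; _^_; _/_; _%_; _≤_; _<_; _<ᵇ_; z≤n; s≤s; >-nonZero)
open import Data.Nat.DivMod
open import Data.Nat.Induction using (<-wellFounded-fast)
open import Data.Nat.Properties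
open import Data.Nat.Tactic.RingSolver using (solve-∀)
open import Data.Product using (_,_; _×_; proj₁; proj₂; ∃)
open import Data.Rational as ℚ using (toℚᵘ)
import Data.Rational.Properties as ℚ
open import Algebra.Properties.Group ℚ.+-0-group using (⁻¹-involutive)
open import Data.Rational.Unnormalised as ℚᵘ using (mkℚᵘ; *<*; *≤*)
import Data.Rational.Unnormalised.Properties as ℚᵘ
open import Data.Sum using (inj₁; inj₂)
open import Induction.WellFounded using (Acc; acc; acc-inverse)
open import Relation.Binary.PropositionalEquality
open import Relation.Nullary using (yes; no; contradiction; ¬¬-excluded-middle)
open import Relation.Nullary.Decidable using (from-yes)
open import Relation.Nullary.Reflects using (ofʸ; ofⁿ)

mutual
  digitsFrom : ℕ → ∀ {m} → Acc _<_ m → List ℕ → List ℕ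
  digitsFrom = _

  -- `toNatDigits` runs an accumulator loop hidden in a `where` block (its
  -- first argument is the outer argument of `toNatDigits`, unused by the
  -- loop).  Once every argument of the loop is abstracted to a variable, this
  -- equation is a pattern for unification, which solves `digitsFrom` as it.
  private
    digitsFrom-solution : ∀ v → (0 <ᵇ suc v / 10) ≡ true →
      digitsFrom (suc v) (acc-inverse (<-wellFounded-fast (suc (suc v / 10))) (n<1+n (suc v / 10))) (suc v % 10 ∷ [])
        ≡ toNatDigits 10 (suc v)
    digitsFrom-solution v eq with 0 <ᵇ suc v / 10
    digitsFrom-solution v refl | true with suc v / 10
    ... | m with acc-inverse (<-wellFounded-fast (suc m)) (n<1+n m) | suc v % 10 ∷ [] | suc v
    ... | _ | _ | _ = refl

shiftIn : ℕ → ℕ → ℕ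
shiftIn n d = 10 * n + d

10*[n/10]+n%10≡n : ∀ n → 10 * (n / 10) + n % 10 ≡ n
10*[n/10]+n%10≡n n = begin
  10 * (n / 10) + n % 10 ≡⟨ +-comm (10 * (n / 10)) (n % 10) ⟩
  n % 10 + 10 * (n / 10) ≡⟨ cong (λ q → n % 10 + q) (*-comm 10 (n / 10)) ⟩
  n % 10 + n / 10 * 10   ≡⟨ m≡m%n+[m/n]*n n 10 ⟨
  n                      ∎
  where open ≡-Reasoning

[1+n]/10<1+n : ∀ n → suc n / 10 < suc n
[1+n]/10<1+n n = m/n<m (suc n) 10 (s≤s (s≤s z≤n))

digitsFrom-value : ∀ p {m} (a : Acc _<_ m) xs → foldl shiftIn 0 (digitsFrom p a xs) ≡ foldl shiftIn m xs
digitsFrom-value p {zero} a xs = refl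
digitsFrom-value p {suc n} (acc rec) xs with 0 <ᵇ suc n / 10 | <ᵇ-reflects-< 0 (suc n / 10)
... | false | ofⁿ n/10≯0 =
  cong (λ z → foldl shiftIn z xs) (trans (cong (λ q → 10 * q + suc n % 10) (sym n/10≡0)) (10*[n/10]+n%10≡n (suc n)))
  where n/10≡0 = n≤0⇒n≡0 (≮⇒≥ n/10≯0)
... | true | ofʸ _ =
  trans (digitsFrom-value p (rec ([1+n]/10<1+n n)) (suc n % 10 ∷ xs))
        (cong (λ z → foldl shiftIn z xs) (10*[n/10]+n%10≡n (suc n)))

10^[1+q]≤n⇒10^q≤n/10 : ∀ q n → 10 ^ suc q ≤ n → 10 ^ q ≤ n / 10
10^[1+q]≤n⇒10^q≤n/10 q n le =
  subst (_≤ n / 10) (m*n/n≡m (10 ^ q) 10) (/-monoˡ-≤ 10 (subst (_≤ n) (*-comm 10 (10 ^ q)) le))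

n<10^[1+q]⇒n/10<10^q : ∀ q n → n < 10 ^ suc q → n / 10 < 10 ^ q
n<10^[1+q]⇒n/10<10^q q n lt = m<n*o⇒m/o<n (subst (n <_) (*-comm 10 (10 ^ q)) lt)

digitsFrom-length : ∀ p {m} (a : Acc _<_ m) xs q → 10 ^ q ≤ m → m < 10 ^ suc q →
  length (digitsFrom p a xs) ≡ suc q + length xs
digitsFrom-length p {zero} a xs q lo hi = contradiction lo (<⇒≱ (m^n>0 10 q))
digitsFrom-length p {suc n} (acc rec) xs q lo hi with 0 <ᵇ suc n / 10 | <ᵇ-reflects-< 0 (suc n / 10)
digitsFrom-length p {suc n} (acc rec) xs zero lo hi | false | ofⁿ _ = refl
digitsFrom-length p {suc n} (acc rec) xs (suc q) lo hi | false | ofⁿ n/10≯0 =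
  contradiction (m≥n⇒m/n>0 (≤-trans (*-monoʳ-≤ 10 (m^n>0 10 q)) lo)) n/10≯0
digitsFrom-length p {suc n} (acc rec) xs zero lo hi | true | ofʸ n/10>0 =
  contradiction (m<n⇒m/n≡0 hi) (≢-sym (<⇒≢ n/10>0))
digitsFrom-length p {suc n} (acc rec) xs (suc q) lo hi | true | ofʸ _ =
  trans (digitsFrom-length p (rec ([1+n]/10<1+n n)) (suc n % 10 ∷ xs) q
           (10^[1+q]≤n⇒10^q≤n/10 q (suc n) lo) (n<10^[1+q]⇒n/10<10^q (suc q) (suc n) hi))
        (+-suc (suc q) (length xs))

digitsValue-decDigits : ∀ n → digitsValue (decDigits n) ≡ n
digitsValue-decDigits n = digitsFrom-value n (<-wellFounded-fast n) []

length-decDigits : ∀ n q → 10 ^ q ≤ n → n < 10 ^ suc q → length (decDigits n) ≡ suc q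
length-decDigits n q lo hi = trans (digitsFrom-length n (<-wellFounded-fast n) [] q lo hi) (+-identityʳ (suc q))

take-length-++ : ∀ {A : Set} {l} (xs ys : List A) → length xs ≡ l → take l (xs ++ ys) ≡ xs
take-length-++ []       ys refl = refl
take-length-++ (x ∷ xs) ys refl = cong (x ∷_) (take-length-++ xs ys refl)

prefixDigits-firstBlock : ∀ k n p → length (decDigits (k * n)) ≡ suc p → prefixDigits k n (suc p) ≡ decDigits (k * n)
prefixDigits-firstBlock k n p len rewrite +-identityʳ n = take-length-++ (decDigits (k * n)) _ len

digitsValue-prefixDigits : ∀ k n p → 10 ^ p ≤ k * n → k * n < 10 ^ suc p →
  digitsValue (prefixDigits k n (suc p)) ≡ k * n
digitsValue-prefixDigits k n p lo hi = begin
  digitsValue (prefixDigits k n (suc p)) ≡⟨ cong digitsValue (prefixDigits-firstBlock k n p (length-decDigits (k * n) p lo hi)) ⟩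
  digitsValue (decDigits (k * n))        ≡⟨ digitsValue-decDigits (k * n) ⟩
  k * n                                  ∎
  where open ≡-Reasoning

toℚᵘ-/ : ∀ i d → toℚᵘ ((+ i) ℚ./ suc d) ℚᵘ.≃ mkℚᵘ (+ i) d
toℚᵘ-/ i d = ℚ.toℚᵘ-fromℚᵘ (mkℚᵘ (+ i) d)

/-<-/⇒ : ∀ a b c d .{{_ : NonZero b}} .{{_ : NonZero d}} → (+ a) ℚ./ b ℚ.< (+ c) ℚ./ d → a * d < c * b
/-<-/⇒ a (suc b) c (suc d) lt with ℚᵘ.<-respʳ-≃ (toℚᵘ-/ c d) (ℚᵘ.<-respˡ-≃ (toℚᵘ-/ a b) (ℚ.toℚᵘ-mono-< lt))
... | *<* h = ℤ.drop‿+<+ (subst₂ ℤ._<_ (sym (ℤ.pos-* a (suc d))) (sym (ℤ.pos-* c (suc b))) h)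

/-≤-/+/⇒ : ∀ a b v w d .{{_ : NonZero b}} .{{_ : NonZero d}} →
  (+ a) ℚ./ b ℚ.≤ (+ v) ℚ./ d ℚ.+ (+ w) ℚ./ d → a * (d * d) ≤ (v * d + w * d) * b
/-≤-/+/⇒ a (suc b) v w (suc d) le
  with ℚᵘ.≤-respʳ-≃ (ℚᵘ.≃-trans (ℚ.toℚᵘ-homo-+ ((+ v) ℚ./ suc d) ((+ w) ℚ./ suc d)) (ℚᵘ.+-cong (toℚᵘ-/ v d) (toℚᵘ-/ w d)))
                    (ℚᵘ.≤-respˡ-≃ (toℚᵘ-/ a b) (ℚ.toℚᵘ-mono-≤ le))
... | *≤* h = ℤ.drop‿+≤+ (subst₂ ℤ._≤_ (sym (ℤ.pos-* a _)) (trans sum≡ (sym (ℤ.pos-* (v * suc d + w * suc d) (suc b)))) h)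
  where
  sum≡ = cong₂ (λ x y → (x ℤ.+ y) ℤ.* + suc b) (ℤ.+◃n≡+n (v * suc d)) (ℤ.+◃n≡+n (w * suc d))

[v*D+1*D]*10≡10[1+v]*D : ∀ v D → (v * D + 1 * D) * 10 ≡ 10 * suc v * D
[v*D+1*D]*10≡10[1+v]*D = solve-∀

2*[10M]≡10*[2M] : ∀ M → 2 * (10 * M) ≡ 10 * (2 * M)
2*[10M]≡10*[2M] = solve-∀

leadingOne⇒¬LeX-fifth : ∀ k n p → 10 ^ p ≤ k * n → suc (k * n) < 2 * 10 ^ p → ¬ LeX k n ((+ 2) ℚ./ 10)
leadingOne⇒¬LeX-fifth k n p lo hi lex = <⇒≱ hi 2M≤1+v
  where
  v = k * n
  M = 10 ^ p
  D = 10 ^ suc p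
  instance
    D≢0 : NonZero D
    D≢0 = m^n≢0 10 (suc p)
  v<D : v < D
  v<D = <-≤-trans (<-trans (n<1+n v) hi) (*-monoˡ-≤ M {2} {10} (s≤s (s≤s z≤n)))
  fifth≤ : (+ 2) ℚ./ 10 ℚ.≤ (+ v) ℚ./ D ℚ.+ (+ 1) ℚ./ D
  fifth≤ = subst (λ z → (+ 2) ℚ./ 10 ℚ.≤ (+ z) ℚ./ D ℚ.+ (+ 1) ℚ./ D)
                 (digitsValue-prefixDigits k n p lo v<D) (lex (suc p))
  2D≤10[1+v] : 2 * D ≤ 10 * suc v
  2D≤10[1+v] = *-cancelʳ-≤ (2 * D) (10 * suc v) D
    (subst₂ _≤_ (sym (*-assoc 2 D D)) ([v*D+1*D]*10≡10[1+v]*D v D) (/-≤-/+/⇒ 2 10 v 1 D fifth≤))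
  2M≤1+v : 2 * M ≤ suc v
  2M≤1+v = *-cancelˡ-≤ 10 (subst (_≤ 10 * suc v) (2*[10M]≡10*[2M] M) 2D≤10[1+v])

∣p∣<q⇒-q<p : ∀ p q → ℚ.∣ p ∣ ℚ.< q → ℚ.- q ℚ.< p
∣p∣<q⇒-q<p p q ∣p∣<q with ℚ.∣p∣≡p∨∣p∣≡-p p
... | inj₁ ∣p∣≡p  = ℚ.<-≤-trans (ℚ.neg-antimono-< (ℚ.≤-<-trans (ℚ.0≤∣p∣ p) ∣p∣<q)) (ℚ.∣p∣≡p⇒0≤p ∣p∣≡p)
... | inj₂ ∣p∣≡-p = subst (ℚ.- q ℚ.<_) (⁻¹-involutive p) (ℚ.neg-antimono-< (subst (ℚ._< q) ∣p∣≡-p ∣p∣<q))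

∣p-q∣<r⇒q-r<p : ∀ p q r → ℚ.∣ p ℚ.- q ∣ ℚ.< r → q ℚ.- r ℚ.< p
∣p-q∣<r⇒q-r<p p q r lt = subst₂ ℚ._<_ (ℚ.+-comm (ℚ.- r) q) p-q+q≡p (ℚ.+-monoˡ-< q (∣p∣<q⇒-q<p (p ℚ.- q) r lt))
  where
  open ≡-Reasoning
  p-q+q≡p : p ℚ.- q ℚ.+ q ≡ p
  p-q+q≡p = begin
    p ℚ.- q ℚ.+ q       ≡⟨ ℚ.+-assoc p (ℚ.- q) q ⟩
    p ℚ.+ (ℚ.- q ℚ.+ q) ≡⟨ cong (p ℚ.+_) (ℚ.+-inverseˡ q) ⟩
    p ℚ.+ ℚ.0ℚ          ≡⟨ ℚ.+-identityʳ p ⟩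
    p                   ∎

ratio-near-8/9⇒>7/9 : ∀ c N → ℚ.∣ (+ c) ℚ./ suc N ℚ.- (ℚ.1ℚ ℚ.- (+ 2) ℚ./ 10) ℚ.* ((+ 10) ℚ./ 9) ∣ ℚ.< (+ 1) ℚ./ 9 →
  7 * suc N < c * 9
ratio-near-8/9⇒>7/9 c N near = /-<-/⇒ 7 9 c (suc N) (∣p-q∣<r⇒q-r<p (+ c ℚ./ suc N) 8/9 1/9 near)
  where
  8/9 = (ℚ.1ℚ ℚ.- (+ 2) ℚ./ 10) ℚ.* ((+ 10) ℚ./ 9)
  1/9 = (+ 1) ℚ./ 9

CountIs-≤ : ∀ {P N c} → CountIs P N c → c ≤ N
CountIs-≤ cnt-zero           = z≤n
CountIs-≤ (cnt-yes _ count) = s≤s (CountIs-≤ count)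
CountIs-≤ (cnt-no _ count)  = m≤n⇒m≤1+n (CountIs-≤ count)

CountIs-≤-absentAbove : ∀ {P N c} L → (∀ n → L < n → n ≤ N → ¬ P n) → CountIs P N c → c ≤ L
CountIs-≤-absentAbove L absent cnt-zero = z≤n
CountIs-≤-absentAbove {N = suc N} L absent (cnt-yes p count) with suc N ≤? L
... | yes 1+N≤L = ≤-trans (s≤s (CountIs-≤ count)) 1+N≤L
... | no 1+N≰L  = contradiction p (absent (suc N) (≰⇒> 1+N≰L) ≤-refl)
CountIs-≤-absentAbove L absent (cnt-no _ count) =
  CountIs-≤-absentAbove L (λ n L<n n≤N → absent n L<n (m≤n⇒m≤1+n n≤N)) count

¬¬-∃-CountIs : ∀ P N → ¬ ¬ ∃ (CountIs P N)
¬¬-∃-CountIs P zero    ¬count = ¬count (0 , cnt-zero)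
¬¬-∃-CountIs P (suc N) ¬count = ¬¬-∃-CountIs P N λ (c , count) → ¬¬-excluded-middle λ where
  (yes p)  → ¬count (suc c , cnt-yes p count)
  (no ¬p) → ¬count (c , cnt-no ¬p count)

m<[1+m/n]*n : ∀ m n .{{_ : NonZero n}} → m < suc (m / n) * n
m<[1+m/n]*n m n = begin-strict
  m                 ≡⟨ m≡m%n+[m/n]*n m n ⟩
  m % n + m / n * n <⟨ +-monoˡ-< (m / n * n) (m%n<n m n) ⟩
  suc (m / n) * n   ∎
  where open ≤-Reasoning

m*n≤o⇒m≤o/n : ∀ m n o .{{_ : NonZero n}} → m * n ≤ o → m ≤ o / n
m*n≤o⇒m≤o/n m n o le = subst (_≤ o / n) (m*n/n≡m m n) (/-monoˡ-≤ n le)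

k*[2q]≡2*[q*k] : ∀ k q → k * (2 * q) ≡ 2 * (q * k)
k*[2q]≡2*[q*k] = solve-∀

leadingBlock-window : ∀ k M n .{{_ : NonZero k}} .{{_ : NonZero M}} →
  pred M / k < n → n ≤ 2 * (pred M / k) → M ≤ k * n × suc (k * n) < 2 * M
leadingBlock-window k (suc m) n m/k<n n≤2[m/k] = m<kn , subst (suc (k * n) <_) (sym (*-suc 2 m)) (s≤s (s≤s kn≤2m))
  where
  m<kn : m < k * n
  m<kn = <-≤-trans (m<[1+m/n]*n m k) (subst (suc (m / k) * k ≤_) (*-comm n k) (*-monoˡ-≤ k m/k<n))
  kn≤2m : k * n ≤ 2 * m
  kn≤2m = ≤-trans (*-monoʳ-≤ k n≤2[m/k])
                  (subst (_≤ 2 * m) (sym (k*[2q]≡2*[q*k] k (m / k))) (*-monoʳ-≤ 2 (m/n*n≤m m k)))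

n<10^n : ∀ n → n < 10 ^ n
n<10^n zero    = s≤s z≤n
n<10^n (suc n) = ≤-<-trans (n<10^n n) (subst (10 ^ n <_) (*-comm (10 ^ n) 10) (m<m*n (10 ^ n) 10 (s≤s (s≤s z≤n))))
  where instance _ = m^n≢0 10 n

c≤L⇒c*9≤7*[2L] : ∀ c L → c ≤ L → c * 9 ≤ 7 * (2 * L)
c≤L⇒c*9≤7*[2L] c L c≤L = begin
  c * 9       ≤⟨ *-monoˡ-≤ 9 c≤L ⟩
  L * 9       ≤⟨ *-monoʳ-≤ L {9} {14} (m≤m+n 9 5) ⟩
  L * 14      ≡⟨ L*14≡7*[2L] L ⟩
  7 * (2 * L) ∎
  where
  open ≤-Reasoning
  L*14≡7*[2L] : ∀ L → L * 14 ≡ 7 * (2 * L)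
  L*14≡7*[2L] = solve-∀

InFifthToOne : ℕ → ℕ → Set
InFifthToOne k n = InInterval k n ((+ 2) ℚ./ 10) ℚ.1ℚ

eventually-fewInFifthToOne : ∀ k .{{_ : NonZero k}} N₀ →
  ∃ λ N → N₀ ≤ N × (∀ c → CountIs (InFifthToOne k) (suc N) c → c * 9 ≤ 7 * suc N)
eventually-fewInFifthToOne k N₀ = N , N₀≤N , λ c count →
  subst (λ z → c * 9 ≤ 7 * z) (sym 1+N≡2L) (c≤L⇒c*9≤7*[2L] c L (CountIs-≤-absentAbove L absentAbove count))
  where
  T = suc N₀ * k
  M = 10 ^ T
  instance
    _ = m^n≢0 10 T
  L = pred M / k
  N = pred (2 * L)
  N₀<L : N₀ < L
  N₀<L = m*n≤o⇒m≤o/n (suc N₀) k (pred M) (≤-pred (subst (suc T ≤_) (sym (suc-pred M)) (n<10^n T)))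
  1+N≡2L : suc N ≡ 2 * L
  1+N≡2L = suc-pred (2 * L) {{>-nonZero (*-monoʳ-< 2 (<-≤-trans (s≤s z≤n) N₀<L))}}
  N₀≤N : N₀ ≤ N
  N₀≤N = ≤-pred (subst (suc N₀ ≤_) (sym 1+N≡2L) (≤-trans N₀<L (m≤m+n L (L + 0))))
  absentAbove : ∀ n → L < n → n ≤ suc N → ¬ InFifthToOne k n
  absentAbove n L<n n≤1+N (fifth≤xₙ , _) = leadingOne⇒¬LeX-fifth k n T M≤kn kn<2M fifth≤xₙ
    where
    window = leadingBlock-window k M n L<n (subst (n ≤_) 1+N≡2L n≤1+N)
    M≤kn = proj₁ window
    kn<2M = proj₂ window

theorem2 : (k : ℕ) → NonZero k → ¬ UniformlyDistributedOverTenthToOne k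
theorem2 k k≢0 ud = ¬¬-∃-CountIs (InFifthToOne k) (suc N) λ (c , count) →
  <⇒≱ (ratio-near-8/9⇒>7/9 c N (converges N N₀≤N c count)) (few c count)
  where
  convergence = ud ((+ 2) ℚ./ 10) ℚ.1ℚ (from-yes ((+ 1) ℚ./ 10 ℚ.≤? (+ 2) ℚ./ 10)) (from-yes ((+ 2) ℚ./ 10 ℚ.<? ℚ.1ℚ))
                   ℚ.≤-refl ((+ 1) ℚ./ 9) (from-yes (ℚ.0ℚ ℚ.<? (+ 1) ℚ./ 9))
  N₀ = proj₁ convergence
  converges = proj₂ convergence
  fewAfterN₀ = eventually-fewInFifthToOne k {{k≢0}} N₀
  N = proj₁ fewAfterN₀
  N₀≤N = proj₁ (proj₂ fewAfterN₀)
  few = proj₂ (proj₂ fewAfterN₀)
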